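{- Let $r\ge2$ and let $H=K_r-e$ be the complete graph $K_r$ with one edge removed. Then for every graph $G$ with $n\ge1$ vertices, the independence polynomial $I(G\circ H;x)$ is symmetric and unimodal; moreover its mode is unique and equal to $n$.
   Context: All graphs are finite and simple. An independent set is a set of pairwise non-adjacent vertices; if $s_k$ is the number of independent sets of size $k$ in a graph $F$ and $\alpha(F)$ the largest size of an independent set, the independence polynomial is $I(F;x)=\sum_{k=0}^{\alpha(F)}s_kx^k$. The corona $G\circ H$ is the graph obtained from $G$ and $|V(G)|$ disjoint copies of $H$, one for each vertex of $G$, by joining each vertex of $G$ to all vertices of its copy of $H$. A polynomial $\sum_{k=0}^{N}a_kx^k$ of degree $N$ is symmetric if $a_i=a_{N-i}$ for all $i$, and unimodal if there is an index $k$ (a mode) with $a_0\le\cdots\le a_{k-1}\le a_k\ge a_{k+1}\ge\cdots\ge a_N$; the mode is unique if exactly one index has this property. -}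

module Defs where

open import Data.Bool using (Bool; true; false; _∧_; not; T)
open import Data.Bool.Properties using (∧-comm)
open import Data.Nat using (ℕ; zero; suc; _+_; _*_; _∸_; _≤_; _<_; _⊔_; _≡ᵇ_)
open import Data.Fin using (Fin; toℕ; splitAt; remQuot) renaming (_≟_ to _≟F_)
open import Data.Fin.Subset using (Subset; ∣_∣)
open import Data.Vec using (Vec; []; _∷_; lookup)
open import Data.List using (List; []; _∷_; _++_; map; filterᵇ; length; foldr; allFin)
open import Data.Bool.ListAction using (and)
open import Data.Nat.Properties using (+-comm)
open import Data.Product using (_×_; _,_; ∃)
open import Data.Sum using (_⊎_; inj₁; inj₂)
open import Relation.Nullary.Decidable using (⌊_⌋)
open import Relation.Nullary using (yes; no)
open import Relation.Binary.PropositionalEquality using (_≡_; refl; sym; cong; cong₂)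

record Graph (n : ℕ) : Set where
  field
    adj     : Fin n → Fin n → Bool
    adj-sym : ∀ u v → adj u v ≡ adj v u
    adj-irr : ∀ u → adj u u ≡ false
open Graph public

_==_ : ∀ {n} → Fin n → Fin n → Bool
u == v = ⌊ u ≟F v ⌋

==-sym : ∀ {n} (u v : Fin n) → (u == v) ≡ (v == u)
==-sym u v with u ≟F v | v ≟F u
... | yes _ | yes _ = refl
... | no _  | no _  = refl
... | yes p | no q  with q (sym p)
... | ()
==-sym u v | no p | yes q with p (sym q)
... | ()

-- K_r - e : complete graph on Fin r with the edge {0,1} removed
-- (any removed edge gives an isomorphic graph)

isEdge01 : ∀ {r} → Fin r → Fin r → Bool
isEdge01 u v = (toℕ u + toℕ v) ≡ᵇ 1

isEdge01-sym : ∀ {r} (u v : Fin r) → isEdge01 u v ≡ isEdge01 v u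
isEdge01-sym u v = cong (_≡ᵇ 1) (+-comm (toℕ u) (toℕ v))

Kminus-e : (r : ℕ) → Graph r
Kminus-e r = record
  { adj     = λ u v → not (u == v) ∧ not (isEdge01 u v)
  ; adj-sym = λ u v → cong₂ (λ a b → not a ∧ not b) (==-sym u v) (isEdge01-sym u v)
  ; adj-irr = irr
  }
  where
  irr : ∀ u → (not (u == u) ∧ not (isEdge01 u u)) ≡ false
  irr u with u ≟F u
  ... | yes _ = refl
  ... | no p with p refl
  ... | ()

-- Corona G ∘ H.  Vertices of G ∘ H are Fin (n + n * m): via splitAt,
-- inj₁ u is vertex u of G, inj₂ p with remQuot m p = (u , h) is vertex h
-- of the copy of H attached to u.

coronaAdj′ : ∀ {n m} → Graph n → Graph m →
             Fin n ⊎ (Fin n × Fin m) → Fin n ⊎ (Fin n × Fin m) → Bool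
coronaAdj′ G H (inj₁ u) (inj₁ v) = adj G u v
coronaAdj′ G H (inj₁ u) (inj₂ (v , h)) = u == v
coronaAdj′ G H (inj₂ (u , h)) (inj₁ v) = u == v
coronaAdj′ G H (inj₂ (u , h)) (inj₂ (v , k)) = (u == v) ∧ adj H h k

split : ∀ {n} m → Fin (n + n * m) → Fin n ⊎ (Fin n × Fin m)
split {n} m i with splitAt n i
... | inj₁ u = inj₁ u
... | inj₂ p = inj₂ (remQuot m p)

coronaAdj′-sym : ∀ {n m} (G : Graph n) (H : Graph m) x y →
                 coronaAdj′ G H x y ≡ coronaAdj′ G H y x
coronaAdj′-sym G H (inj₁ u) (inj₁ v) = adj-sym G u v
coronaAdj′-sym G H (inj₁ u) (inj₂ (v , h)) = ==-sym u v
coronaAdj′-sym G H (inj₂ (u , h)) (inj₁ v) = ==-sym u v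
coronaAdj′-sym G H (inj₂ (u , h)) (inj₂ (v , k)) =
  cong₂ _∧_ (==-sym u v) (adj-sym H h k)

coronaAdj′-irr : ∀ {n m} (G : Graph n) (H : Graph m) x →
                 coronaAdj′ G H x x ≡ false
coronaAdj′-irr G H (inj₁ u) = adj-irr G u
coronaAdj′-irr G H (inj₂ (u , h)) rewrite adj-irr H h = ∧-comm (u == u) false

corona : ∀ {n m} → Graph n → Graph m → Graph (n + n * m)
corona {m = m} G H = record
  { adj     = λ i j → coronaAdj′ G H (split m i) (split m j)
  ; adj-sym = λ i j → coronaAdj′-sym G H (split m i) (split m j)
  ; adj-irr = λ i → coronaAdj′-irr G H (split m i)
  }

subsets : (n : ℕ) → List (Subset n)
subsets zero    = [] ∷ []
subsets (suc n) = map (true ∷_) (subsets n) ++ map (false ∷_) (subsets n)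

isIndependent : ∀ {n} → Graph n → Subset n → Bool
isIndependent {n} F S =
  and (map (λ i → and (map (λ j → not (lookup S i ∧ lookup S j ∧ adj F i j)) (allFin n))) (allFin n))

independentSets : ∀ {n} → Graph n → List (Subset n)
independentSets {n} F = filterᵇ (isIndependent F) (subsets n)

-- s_k : number of independent sets of size k = coefficient of x^k in I(F;x)
indepCoeff : ∀ {n} → Graph n → ℕ → ℕ
indepCoeff F k = length (filterᵇ (λ S → ∣ S ∣ ≡ᵇ k) (independentSets F))

-- α(F) : largest size of an independent set = degree of I(F;x)
indepNumber : ∀ {n} → Graph n → ℕ
indepNumber F = foldr _⊔_ 0 (map ∣_∣ (independentSets F))

Symmetric : (ℕ → ℕ) → ℕ → Set
Symmetric a N = ∀ i → i ≤ N → a i ≡ a (N ∸ i)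

IsMode : (ℕ → ℕ) → ℕ → ℕ → Set
IsMode a N k = k ≤ N × (∀ i → i < k → a i ≤ a (suc i))
                     × (∀ i → k ≤ i → i < N → a (suc i) ≤ a i)

Unimodal : (ℕ → ℕ) → ℕ → Set
Unimodal a N = ∃ λ k → IsMode a N k

UniqueModeAt : (ℕ → ℕ) → ℕ → ℕ → Set
UniqueModeAt a N k = IsMode a N k × (∀ k′ → IsMode a N k′ → k′ ≡ k)

module Submission where

-- Splitting an independent set of G ∘ H by its trace A on V(G) gives
-- I(G ∘ H; x) = Σ_A x^|A| I(H; x)^(n − |A|), summed over the independent sets A of G, and
-- I(K_r − e; x) = 1 + r x + x² = (1 + x)² + (r − 2) x.  Multiplying a symmetric unimodal
-- coefficient sequence by 1 + x, or by x while padding its degree by two, keeps it symmetric and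
-- unimodal, so every summand is symmetric and unimodal of formal degree 2n with centre n, and so
-- is their sum.  The summand for A = ∅, (1 + r x + x²)^n, rises strictly into its centre, which
-- makes n the unique mode; the degree is exactly 2n because the coefficient of x^(2n) equals the
-- constant coefficient 1.

open import Defs
open import Data.Bool using (Bool; true; false; _∧_; _∨_; not; T; if_then_else_)
open import Data.Bool.ListAction using (and)
open import Data.Bool.Properties using (T-not-≡; T-∧; T-∨; T-≡; T?)
open import Data.Empty using (⊥-elim)
open import Data.Fin using (Fin; combine; _↑ˡ_; _↑ʳ_; splitAt; remQuot)
  renaming (zero to fzero; suc to fsuc; _≟_ to _≟ᶠ_)
open import Data.Fin.Properties using (splitAt-↑ˡ; splitAt-↑ʳ; remQuot-combine; combine-remQuot)
  renaming (suc-injective to fsuc-injective; 0≢1+n to fzero≢fsuc)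
open import Data.Fin.Subset using (Subset; ∣_∣; ⊥)
open import Data.Fin.Subset.Properties using (∣⊥∣≡0)
open import Data.List using ([]; _∷_; map; length; filterᵇ; foldr; allFin) renaming (_++_ to _++ᴸ_)
open import Data.List.Membership.Propositional using (_∈_)
open import Data.List.Membership.Propositional.Properties using (∈-filter⁻)
open import Data.List.Properties using (filter-++; length-++; filter-some)
open import Data.List.Relation.Unary.Any using (here; there)
import Data.List.Relation.Unary.Any as Any
import Data.List.Relation.Unary.All.Properties as All
open import Data.Nat using (ℕ; zero; suc; _+_; _*_; _∸_; _≤_; _<_; _≤?_; _≡ᵇ_; _⊔_; z≤n; s≤s; s≤s⁻¹)
open import Data.Nat.Properties
open import Data.Nat.Tactic.RingSolver using (solve-∀)
open import Data.Product using (_×_; _,_; proj₁; proj₂; ∃)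
open import Data.Product.Function.NonDependent.Propositional using (_×-⇔_)
open import Data.Sum using (_⊎_; inj₁; inj₂)
open import Data.Vec using (Vec; []; _∷_; lookup; _++_; concat)
open import Data.Vec.Properties using (lookup-splitAt; lookup-concat; lookup-replicate)
open import Function using (_∘_; _⇔_; mk⇔; Equivalence)
open import Function.Construct.Composition using (_⇔-∘_)
open import Function.Construct.Symmetry using (⇔-sym)
open import Relation.Binary using (tri<; tri≈; tri>)
open import Relation.Binary.PropositionalEquality
open import Relation.Nullary using (yes; no; ¬_; contradiction)

open Equivalence using (to; from)

𝟙 : Bool → ℕ
𝟙 true  = 1
𝟙 false = 0

𝟙-∧ : ∀ a b → 𝟙 (a ∧ b) ≡ 𝟙 a * 𝟙 b
𝟙-∧ true  b = sym (+-identityʳ (𝟙 b))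
𝟙-∧ false b = refl

𝟙-∧-* : ∀ a b w → 𝟙 (a ∧ b) * w ≡ 𝟙 a * (𝟙 b * w)
𝟙-∧-* a b w = trans (cong (_* w) (𝟙-∧ a b)) (*-assoc (𝟙 a) (𝟙 b) w)

∑ : (N : ℕ) → (Subset N → ℕ) → ℕ
∑ zero    w = w []
∑ (suc N) w = ∑ N (w ∘ (true ∷_)) + ∑ N (w ∘ (false ∷_))

∑-cong : ∀ N {v w : Subset N → ℕ} → (∀ S → v S ≡ w S) → ∑ N v ≡ ∑ N w
∑-cong zero    v≗w = v≗w []
∑-cong (suc N) v≗w = cong₂ _+_ (∑-cong N (v≗w ∘ (true ∷_))) (∑-cong N (v≗w ∘ (false ∷_)))

∑-*ˡ : ∀ N c (w : Subset N → ℕ) → ∑ N (λ S → c * w S) ≡ c * ∑ N w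
∑-*ˡ zero    c w = refl
∑-*ˡ (suc N) c w = trans (cong₂ _+_ (∑-*ˡ N c _) (∑-*ˡ N c _))
                         (sym (*-distribˡ-+ c (∑ N _) (∑ N _)))

∑-mono-≤ : ∀ N {v w : Subset N → ℕ} → (∀ S → v S ≤ w S) → ∑ N v ≤ ∑ N w
∑-mono-≤ zero    v≤w = v≤w []
∑-mono-≤ (suc N) v≤w =
  +-mono-≤ (∑-mono-≤ N (v≤w ∘ (true ∷_))) (∑-mono-≤ N (v≤w ∘ (false ∷_)))

∑-mono-< : ∀ N {v w : Subset N → ℕ} S → (∀ S → v S ≤ w S) → v S < w S → ∑ N v < ∑ N w
∑-mono-< zero    []          v≤w v<w = v<w
∑-mono-< (suc N) (true ∷ S)  v≤w v<w =
  +-mono-<-≤ (∑-mono-< N S (v≤w ∘ (true ∷_)) v<w) (∑-mono-≤ N (v≤w ∘ (false ∷_)))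
∑-mono-< (suc N) (false ∷ S) v≤w v<w =
  +-mono-≤-< (∑-mono-≤ N (v≤w ∘ (true ∷_))) (∑-mono-< N S (v≤w ∘ (false ∷_)) v<w)

∑-++ : ∀ n m (w : Subset (n + m) → ℕ) → ∑ (n + m) w ≡ ∑ n (λ A → ∑ m (λ B → w (A ++ B)))
∑-++ zero    m w = refl
∑-++ (suc n) m w = cong₂ _+_ (∑-++ n m _) (∑-++ n m _)

∑ⱽ : (n m : ℕ) → (Vec (Subset m) n → ℕ) → ℕ
∑ⱽ zero    m w = w []
∑ⱽ (suc n) m w = ∑ m (λ B → ∑ⱽ n m (w ∘ (B ∷_)))

∑ⱽ-cong : ∀ n m {v w : Vec (Subset m) n → ℕ} →
          (∀ Bs → v Bs ≡ w Bs) → ∑ⱽ n m v ≡ ∑ⱽ n m w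
∑ⱽ-cong zero    m v≗w = v≗w []
∑ⱽ-cong (suc n) m v≗w = ∑-cong m (λ B → ∑ⱽ-cong n m (v≗w ∘ (B ∷_)))

∑ⱽ-*ˡ : ∀ n m c (w : Vec (Subset m) n → ℕ) → ∑ⱽ n m (λ Bs → c * w Bs) ≡ c * ∑ⱽ n m w
∑ⱽ-*ˡ zero    m c w = refl
∑ⱽ-*ˡ (suc n) m c w = trans (∑-cong m (λ B → ∑ⱽ-*ˡ n m c _)) (∑-*ˡ m c _)

∑-concat : ∀ n m (w : Subset (n * m) → ℕ) → ∑ (n * m) w ≡ ∑ⱽ n m (w ∘ concat)
∑-concat zero    m w = refl
∑-concat (suc n) m w = trans (∑-++ m (n * m) w) (∑-cong m (λ B → ∑-concat n m _))

isEmpty : ∀ {m} → Subset m → Bool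
isEmpty []      = true
isEmpty (b ∷ B) = not b ∧ isEmpty B

∑-isEmpty : ∀ m (w : Subset m → ℕ) → ∑ m (λ B → 𝟙 (isEmpty B) * w B) ≡ w ⊥
∑-isEmpty zero    w = +-identityʳ (w [])
∑-isEmpty (suc m) w = cong₂ _+_ (∑-*ˡ m 0 (w ∘ (true ∷_))) (∑-isEmpty m (w ∘ (false ∷_)))

length-filterᵇ-map : ∀ {A B : Set} (p : B → Bool) (f : A → B) xs →
  length (filterᵇ p (map f xs)) ≡ length (filterᵇ (p ∘ f) xs)
length-filterᵇ-map p f []       = refl
length-filterᵇ-map p f (x ∷ xs) with p (f x)
... | true  = cong suc (length-filterᵇ-map p f xs)
... | false = length-filterᵇ-map p f xs

length-filterᵇ-filterᵇ : ∀ {A : Set} (p q : A → Bool) xs →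
  length (filterᵇ q (filterᵇ p xs)) ≡ length (filterᵇ (λ x → p x ∧ q x) xs)
length-filterᵇ-filterᵇ p q []       = refl
length-filterᵇ-filterᵇ p q (x ∷ xs) with p x
... | false = length-filterᵇ-filterᵇ p q xs
... | true with q x
...   | true  = cong suc (length-filterᵇ-filterᵇ p q xs)
...   | false = length-filterᵇ-filterᵇ p q xs

length-filterᵇ-subsets : ∀ N (p : Subset N → Bool) →
                         length (filterᵇ p (subsets N)) ≡ ∑ N (𝟙 ∘ p)
length-filterᵇ-subsets zero    p with p []
... | true  = refl
... | false = refl
length-filterᵇ-subsets (suc N) p = begin
  length (filterᵇ p (map (true ∷_) (subsets N) ++ᴸ map (false ∷_) (subsets N)))
    ≡⟨ cong length (filter-++ _ (map (true ∷_) (subsets N)) _) ⟩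
  length (filterᵇ p (map (true ∷_) (subsets N)) ++ᴸ filterᵇ p (map (false ∷_) (subsets N)))
    ≡⟨ length-++ (filterᵇ p (map (true ∷_) (subsets N))) ⟩
  length (filterᵇ p (map (true ∷_) (subsets N))) + length (filterᵇ p (map (false ∷_) (subsets N)))
    ≡⟨ cong₂ _+_ (length-filterᵇ-map p _ (subsets N)) (length-filterᵇ-map p _ (subsets N)) ⟩
  length (filterᵇ (p ∘ (true ∷_)) (subsets N)) + length (filterᵇ (p ∘ (false ∷_)) (subsets N))
    ≡⟨ cong₂ _+_ (length-filterᵇ-subsets N _) (length-filterᵇ-subsets N _) ⟩
  ∑ (suc N) (𝟙 ∘ p) ∎
  where open ≡-Reasoning

indepCoeff≡∑ : ∀ {N} (F : Graph N) k →
  indepCoeff F k ≡ ∑ N (λ S → 𝟙 (isIndependent F S ∧ (∣ S ∣ ≡ᵇ k)))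
indepCoeff≡∑ {N} F k =
  trans (length-filterᵇ-filterᵇ (isIndependent F) (λ S → ∣ S ∣ ≡ᵇ k) (subsets N))
        (length-filterᵇ-subsets N _)

T-injective : ∀ {a b} → T a ⇔ T b → a ≡ b
T-injective {false} {false} _   = refl
T-injective {false} {true}  a⇔b = ⊥-elim (from a⇔b _)
T-injective {true}  {false} a⇔b = ⊥-elim (to a⇔b _)
T-injective {true}  {true}  _   = refl

Independent : ∀ {N} → Graph N → Subset N → Set
Independent F S = ∀ i j → T (lookup S i) → T (lookup S j) → adj F i j ≡ false

T-all-allFin : ∀ {N} (p : Fin N → Bool) → T (and (map p (allFin N))) ⇔ (∀ i → T (p i))
T-all-allFin {N} p = mk⇔ (λ t → All.tabulate⁻ (All.all⁺ p (allFin N) t))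
                         (λ f → All.all⁻ p (All.tabulate⁺ f))

isIndependent⇔Independent : ∀ {N} (F : Graph N) S → T (isIndependent F S) ⇔ Independent F S
isIndependent⇔Independent F S = mk⇔
  (λ t i j → pair⇒ (lookup S i) (lookup S j) (to (T-all-allFin _) (to (T-all-allFin _) t i) j))
  (λ I → from (T-all-allFin _) λ i → from (T-all-allFin _) λ j → ⇒pair (lookup S i) (lookup S j) (I i j))
  where
  pair⇒ : ∀ a b {c} → T (not (a ∧ b ∧ c)) → T a → T b → c ≡ false
  pair⇒ true true t _ _ = to T-not-≡ t
  ⇒pair : ∀ a b {c} → (T a → T b → c ≡ false) → T (not (a ∧ b ∧ c))
  ⇒pair false b     _ = _
  ⇒pair true  false _ = _
  ⇒pair true  true  f = from T-not-≡ (f _ _)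

isIndependent-⊥ : ∀ {N} (F : Graph N) → isIndependent F ⊥ ≡ true
isIndependent-⊥ {N} F = to T-≡
  (from (isIndependent⇔Independent F ⊥) λ i _ ⊥i _ → ⊥-elim (subst T (lookup-replicate i false) ⊥i))

T-isEmpty : ∀ {m} (B : Subset m) → T (isEmpty B) ⇔ (∀ h → ¬ T (lookup B h))
T-isEmpty [] = mk⇔ (λ _ ()) (λ _ → _)
T-isEmpty (true ∷ B) = mk⇔ (λ ()) (λ none → none fzero _)
T-isEmpty (false ∷ B) = mk⇔
  (λ { t fzero → λ () ; t (fsuc h) → to (T-isEmpty B) t h })
  (λ none → from (T-isEmpty B) (none ∘ fsuc))

-- Independent sets of a corona

compatibleAt : ∀ {m} → Graph m → Bool → Subset m → Bool
compatibleAt H true  B = isEmpty B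
compatibleAt H false B = isIndependent H B

compatible : ∀ {n m} → Graph m → Subset n → Vec (Subset m) n → Bool
compatible H []      []       = true
compatible H (a ∷ A) (B ∷ Bs) = compatibleAt H a B ∧ compatible H A Bs

CompatibleAt : ∀ {m} → Graph m → Bool → Subset m → Set
CompatibleAt H a B = Independent H B × (T a → ∀ h → ¬ T (lookup B h))

T-compatibleAt : ∀ {m} (H : Graph m) a B → T (compatibleAt H a B) ⇔ CompatibleAt H a B
T-compatibleAt H true B = mk⇔
  (λ t → (λ i _ Bi _ → ⊥-elim (to (T-isEmpty B) t i Bi)) , λ _ → to (T-isEmpty B) t)
  (λ c → from (T-isEmpty B) (proj₂ c _))
T-compatibleAt H false B = mk⇔
  (λ t → to (isIndependent⇔Independent H B) t , λ ())
  (from (isIndependent⇔Independent H B) ∘ proj₁)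

T-compatible : ∀ {n m} (H : Graph m) A Bs →
  T (compatible {n} H A Bs) ⇔ (∀ u → CompatibleAt H (lookup A u) (lookup Bs u))
T-compatible H []      []       = mk⇔ (λ _ ()) (λ _ → _)
T-compatible H (a ∷ A) (B ∷ Bs) = mk⇔
  (λ t → let (first , rest) = to T-∧ t in
     λ { fzero → to (T-compatibleAt H a B) first
       ; (fsuc u) → to (T-compatible H A Bs) rest u })
  (λ c → from T-∧ (from (T-compatibleAt H a B) (c fzero) , from (T-compatible H A Bs) (c ∘ fsuc)))

label : ∀ {n m} → Subset n → Vec (Subset m) n → Fin n ⊎ (Fin n × Fin m) → Bool
label A Bs (inj₁ u)       = lookup A u
label A Bs (inj₂ (u , h)) = lookup (lookup Bs u) h

lookup-++-concat : ∀ {n m} (A : Subset n) (Bs : Vec (Subset m) n) i →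
  lookup (A ++ concat Bs) i ≡ label A Bs (split m i)
lookup-++-concat {n} {m} A Bs i rewrite lookup-splitAt n A (concat Bs) i with splitAt n i
... | inj₁ u = refl
... | inj₂ p = trans (cong (lookup (concat Bs)) (sym (combine-remQuot {n} m p)))
                     (lookup-concat Bs (proj₁ (remQuot {n} m p)) (proj₂ (remQuot {n} m p)))

encode : ∀ {n} m → Fin n ⊎ (Fin n × Fin m) → Fin (n + n * m)
encode {n} m (inj₁ u)       = u ↑ˡ (n * m)
encode {n} m (inj₂ (u , h)) = n ↑ʳ combine u h

split-encode : ∀ {n} m x → split {n} m (encode m x) ≡ x
split-encode {n} m (inj₁ u) rewrite splitAt-↑ˡ n u (n * m) = refl
split-encode {n} m (inj₂ (u , h))
  rewrite splitAt-↑ʳ n (n * m) (combine u h) | remQuot-combine {n} {m} u h = refl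

CoronaIndependent : ∀ {n m} → Graph n → Graph m → Subset n → Vec (Subset m) n → Set
CoronaIndependent G H A Bs =
  ∀ x y → T (label A Bs x) → T (label A Bs y) → coronaAdj′ G H x y ≡ false

Independent-corona⇔ : ∀ {n m} (G : Graph n) (H : Graph m) A Bs →
  Independent (corona G H) (A ++ concat Bs) ⇔ CoronaIndependent G H A Bs
Independent-corona⇔ {m = m} G H A Bs = mk⇔
  (λ I x y Lx Ly → subst₂ (λ x′ y′ → coronaAdj′ G H x′ y′ ≡ false)
                            (split-encode m x) (split-encode m y)
                            (I (encode m x) (encode m y) (at x Lx) (at y Ly)))
  (λ J i j Si Sj → J (split m i) (split m j) (subst T (lookup-++-concat A Bs i) Si)
                                             (subst T (lookup-++-concat A Bs j) Sj))
  where
  at : ∀ x → T (label A Bs x) → T (lookup (A ++ concat Bs) (encode m x))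
  at x = subst T (sym (trans (lookup-++-concat A Bs (encode m x)) (cong (label A Bs) (split-encode m x))))

==-refl : ∀ {n} (u : Fin n) → (u == u) ≡ true
==-refl u with u ≟ᶠ u
... | yes _  = refl
... | no u≢u = ⊥-elim (u≢u refl)

CoronaIndependent⇔ : ∀ {n m} (G : Graph n) (H : Graph m) A Bs →
  CoronaIndependent G H A Bs ⇔ (Independent G A × (∀ u → CompatibleAt H (lookup A u) (lookup Bs u)))
CoronaIndependent⇔ G H A Bs = mk⇔ necessary sufficient
  where
  Conditions : Set
  Conditions = Independent G A × (∀ u → CompatibleAt H (lookup A u) (lookup Bs u))
  necessary : CoronaIndependent G H A Bs → Conditions
  necessary J = (λ u v → J (inj₁ u) (inj₁ v))
              , λ u → (λ h k Bh Bk → subst (λ b → b ∧ adj H h k ≡ false) (==-refl u)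
                                           (J (inj₂ (u , h)) (inj₂ (u , k)) Bh Bk))
                    , λ Au h Bh → contradiction (trans (sym (==-refl u)) (J (inj₁ u) (inj₂ (u , h)) Au Bh))
                                                λ ()
  sufficient : Conditions → CoronaIndependent G H A Bs
  sufficient (IG , C) (inj₁ u) (inj₁ v) Au Av = IG u v Au Av
  sufficient (IG , C) (inj₁ u) (inj₂ (v , h)) Au Bh with u ≟ᶠ v
  ... | no _     = refl
  ... | yes refl = ⊥-elim (proj₂ (C u) Au h Bh)
  sufficient (IG , C) (inj₂ (u , h)) (inj₁ v) Bh Av with u ≟ᶠ v
  ... | no _     = refl
  ... | yes refl = ⊥-elim (proj₂ (C u) Av h Bh)
  sufficient (IG , C) (inj₂ (u , h)) (inj₂ (v , k)) Bh Bk with u ≟ᶠ v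
  ... | no _     = refl
  ... | yes refl = proj₁ (C u) h k Bh Bk

isIndependent-corona : ∀ {n m} (G : Graph n) (H : Graph m) A Bs →
  isIndependent (corona G H) (A ++ concat Bs) ≡ isIndependent G A ∧ compatible H A Bs
isIndependent-corona G H A Bs = T-injective
  (⇔-sym T-∧
    ⇔-∘ ((⇔-sym (isIndependent⇔Independent G A) ×-⇔ ⇔-sym (T-compatible H A Bs))
    ⇔-∘ (CoronaIndependent⇔ G H A Bs
    ⇔-∘ (Independent-corona⇔ G H A Bs
    ⇔-∘ isIndependent⇔Independent (corona G H) (A ++ concat Bs)))))

-- Independent sets of K_r − e

atMostOne : ∀ {m} → Subset m → Bool
atMostOne []          = true
atMostOne (true ∷ B)  = isEmpty B
atMostOne (false ∷ B) = atMostOne B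

AtMostOne : ∀ {m} → Subset m → Set
AtMostOne B = ∀ i j → T (lookup B i) → T (lookup B j) → i ≡ j

T-atMostOne : ∀ {m} (B : Subset m) → T (atMostOne B) ⇔ AtMostOne B
T-atMostOne [] = mk⇔ (λ _ ()) (λ _ → _)
T-atMostOne (true ∷ B) =
  mk⇔ only-first (λ one → from (T-isEmpty B) (λ h Bh → fzero≢fsuc (one fzero (fsuc h) _ Bh)))
  where
  only-first : T (isEmpty B) → AtMostOne (true ∷ B)
  only-first t fzero    fzero    _  _  = refl
  only-first t fzero    (fsuc j) _  Bj = ⊥-elim (to (T-isEmpty B) t j Bj)
  only-first t (fsuc i) _        Bi _  = ⊥-elim (to (T-isEmpty B) t i Bi)
T-atMostOne (false ∷ B) =
  mk⇔ in-tail λ one → from (T-atMostOne B) λ i j Bi Bj → fsuc-injective (one (fsuc i) (fsuc j) Bi Bj)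
  where
  in-tail : T (atMostOne B) → AtMostOne (false ∷ B)
  in-tail t (fsuc i) (fsuc j) Bi Bj = cong fsuc (to (T-atMostOne B) t i j Bi Bj)

module _ (r : ℕ) where

  private
    K : Graph (suc (suc r))
    K = Kminus-e (suc (suc r))

  adj-Kminus-e-distinct : ∀ (i j : Fin r) → adj K (fsuc (fsuc i)) (fsuc (fsuc j)) ≡ false → i ≡ j
  adj-Kminus-e-distinct i j nonadj with fsuc (fsuc i) ≟ᶠ fsuc (fsuc j)
  ... | yes i≡j = fsuc-injective (fsuc-injective i≡j)
  ... | no  _   = contradiction nonadj λ ()

  Independent-Kminus-e⇔ : ∀ b₀ b₁ (B : Subset r) →
    Independent K (b₀ ∷ b₁ ∷ B) ⇔ (AtMostOne B × (T (b₀ ∨ b₁) → ∀ h → ¬ T (lookup B h)))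
  Independent-Kminus-e⇔ b₀ b₁ B = mk⇔ necessary sufficient
    where
    Conditions : Set
    Conditions = AtMostOne B × (T (b₀ ∨ b₁) → ∀ h → ¬ T (lookup B h))
    necessary : Independent K (b₀ ∷ b₁ ∷ B) → Conditions
    necessary I = (λ i j Bi Bj → adj-Kminus-e-distinct i j (I (fsuc (fsuc i)) (fsuc (fsuc j)) Bi Bj))
                , λ b₀∨b₁ h Bh → outside-edge (to T-∨ b₀∨b₁) h Bh
      where
      outside-edge : T b₀ ⊎ T b₁ → ∀ h → ¬ T (lookup B h)
      outside-edge (inj₁ b₀) h Bh with () ← I fzero (fsuc (fsuc h)) b₀ Bh
      outside-edge (inj₂ b₁) h Bh with () ← I (fsuc fzero) (fsuc (fsuc h)) b₁ Bh
    sufficient : Conditions → Independent K (b₀ ∷ b₁ ∷ B)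
    sufficient (one , excl) fzero           fzero           _  _  = refl
    sufficient (one , excl) fzero           (fsuc fzero)    _  _  = refl
    sufficient (one , excl) (fsuc fzero)    fzero           _  _  = refl
    sufficient (one , excl) (fsuc fzero)    (fsuc fzero)    _  _  = adj-irr K (fsuc fzero)
    sufficient (one , excl) fzero           (fsuc (fsuc j)) b  Bj = ⊥-elim (excl (from T-∨ (inj₁ b)) j Bj)
    sufficient (one , excl) (fsuc fzero)    (fsuc (fsuc j)) b  Bj = ⊥-elim (excl (from T-∨ (inj₂ b)) j Bj)
    sufficient (one , excl) (fsuc (fsuc i)) fzero           Bi b  = ⊥-elim (excl (from T-∨ (inj₁ b)) i Bi)
    sufficient (one , excl) (fsuc (fsuc i)) (fsuc fzero)    Bi b  = ⊥-elim (excl (from T-∨ (inj₂ b)) i Bi)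
    sufficient (one , excl) (fsuc (fsuc i)) (fsuc (fsuc j)) Bi Bj rewrite one i j Bi Bj =
      adj-irr K (fsuc (fsuc j))

  isIndependent-Kminus-e : ∀ b₀ b₁ (B : Subset r) →
    isIndependent K (b₀ ∷ b₁ ∷ B) ≡ (if b₀ ∨ b₁ then isEmpty B else atMostOne B)
  isIndependent-Kminus-e b₀ b₁ B =
    T-injective (⇔-sym (characterise (b₀ ∨ b₁))
                  ⇔-∘ (Independent-Kminus-e⇔ b₀ b₁ B ⇔-∘ isIndependent⇔Independent K (b₀ ∷ b₁ ∷ B)))
    where
    characterise : ∀ c → T (if c then isEmpty B else atMostOne B)
                       ⇔ (AtMostOne B × (T c → ∀ h → ¬ T (lookup B h)))
    characterise true = mk⇔
      (λ t → let none = to (T-isEmpty B) t in (λ i _ Bi _ → ⊥-elim (none i Bi)) , λ _ → none)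
      (λ (_ , excl) → from (T-isEmpty B) (excl _))
    characterise false = mk⇔ (λ t → to (T-atMostOne B) t , λ ()) (from (T-atMostOne B) ∘ proj₁)

∑-atMostOne : ∀ m (F : ℕ → ℕ) → ∑ m (λ B → 𝟙 (atMostOne B) * F ∣ B ∣) ≡ F 0 + m * F 1
∑-atMostOne zero    F = refl
∑-atMostOne (suc m) F = begin
  ∑ m (λ B → 𝟙 (isEmpty B) * F (suc ∣ B ∣)) + ∑ m (λ B → 𝟙 (atMostOne B) * F ∣ B ∣)
    ≡⟨ cong₂ _+_ (∑-isEmpty m (F ∘ suc ∘ ∣_∣)) (∑-atMostOne m F) ⟩
  F (suc ∣ ⊥ {m} ∣) + (F 0 + m * F 1)
    ≡⟨ cong (λ k → F (suc k) + (F 0 + m * F 1)) (∣⊥∣≡0 m) ⟩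
  F 1 + (F 0 + m * F 1)
    ≡⟨ shuffle (F 0) (F 1) m ⟩
  F 0 + suc m * F 1 ∎
  where
  open ≡-Reasoning
  shuffle : ∀ a b m → b + (a + m * b) ≡ a + suc m * b
  shuffle = solve-∀

-- I(H; x) = 1 + r x + x², stated by pairing the coefficients of I(H; x) with an arbitrary
-- weight F on set sizes, which avoids any polynomial arithmetic.
IndependencePoly≡1+_x+x² : ∀ {m} → ℕ → Graph m → Set
IndependencePoly≡1+_x+x² {m} r H =
  ∀ (F : ℕ → ℕ) → ∑ m (λ B → 𝟙 (isIndependent H B) * F ∣ B ∣) ≡ F 0 + r * F 1 + F 2

Kminus-e-independencePoly : ∀ r → IndependencePoly≡1+ suc (suc r) x+x² (Kminus-e (suc (suc r)))
Kminus-e-independencePoly r F = begin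
  (∑ r (weight true true) + ∑ r (weight true false))
    + (∑ r (weight false true) + ∑ r (weight false false))
    ≡⟨ cong₂ _+_ (cong₂ _+_ (∑-cong r (reduce true true)) (∑-cong r (reduce true false)))
                 (cong₂ _+_ (∑-cong r (reduce false true)) (∑-cong r (reduce false false))) ⟩
  (∑ r (λ B → 𝟙 (isEmpty B) * F (2 + ∣ B ∣)) + ∑ r (λ B → 𝟙 (isEmpty B) * F (1 + ∣ B ∣)))
    + (∑ r (λ B → 𝟙 (isEmpty B) * F (1 + ∣ B ∣)) + ∑ r (λ B → 𝟙 (atMostOne B) * F ∣ B ∣))
    ≡⟨ cong₂ _+_ (cong₂ _+_ (∑-isEmpty r _) (∑-isEmpty r _))
                 (cong₂ _+_ (∑-isEmpty r _) (∑-atMostOne r F)) ⟩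
  (F (2 + ∣ ⊥ {r} ∣) + F (1 + ∣ ⊥ {r} ∣)) + (F (1 + ∣ ⊥ {r} ∣) + (F 0 + r * F 1))
    ≡⟨ cong (λ k → (F (2 + k) + F (1 + k)) + (F (1 + k) + (F 0 + r * F 1))) (∣⊥∣≡0 r) ⟩
  (F 2 + F 1) + (F 1 + (F 0 + r * F 1))
    ≡⟨ shuffle (F 0) (F 1) (F 2) r ⟩
  F 0 + suc (suc r) * F 1 + F 2 ∎
  where
  open ≡-Reasoning
  weight : Bool → Bool → Subset r → ℕ
  weight b₀ b₁ B = 𝟙 (isIndependent (Kminus-e (suc (suc r))) (b₀ ∷ b₁ ∷ B)) * F ∣ b₀ ∷ b₁ ∷ B ∣
  reduce : ∀ b₀ b₁ B →
           weight b₀ b₁ B ≡ 𝟙 (if b₀ ∨ b₁ then isEmpty B else atMostOne B) * F ∣ b₀ ∷ b₁ ∷ B ∣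
  reduce b₀ b₁ B = cong (λ b → 𝟙 b * F ∣ b₀ ∷ b₁ ∷ B ∣) (isIndependent-Kminus-e r b₀ b₁ B)
  shuffle : ∀ a b c r → (c + b) + (b + (a + r * b)) ≡ a + suc (suc r) * b + c
  shuffle = solve-∀

∣++∣ : ∀ {a b} (A : Subset a) (B : Subset b) → ∣ A ++ B ∣ ≡ ∣ A ∣ + ∣ B ∣
∣++∣ []          B = refl
∣++∣ (true ∷ A)  B = cong suc (∣++∣ A B)
∣++∣ (false ∷ A) B = ∣++∣ A B

δ₀ : ℕ → ℕ
δ₀ zero    = 1
δ₀ (suc _) = 0

x^_·_ : ℕ → (ℕ → ℕ) → ℕ → ℕ
(x^ zero  · f) k       = f k
(x^ suc s · f) zero    = 0
(x^ suc s · f) (suc k) = (x^ s · f) k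

[1+_x+x²]·_ : ℕ → (ℕ → ℕ) → ℕ → ℕ
([1+ r x+x²]· f) k = f k + r * (x^ 1 · f) k + (x^ 2 · f) k

x^+· : ∀ s t f k → (x^ (s + t) · f) k ≡ (x^ s · (x^ t · f)) k
x^+· zero    t f k       = refl
x^+· (suc s) t f zero    = refl
x^+· (suc s) t f (suc k) = x^+· s t f k

x^·-+ : ∀ s f g k → (x^ s · (λ j → f j + g j)) k ≡ (x^ s · f) k + (x^ s · g) k
x^·-+ zero    f g k       = refl
x^·-+ (suc s) f g zero    = refl
x^·-+ (suc s) f g (suc k) = x^·-+ s f g k

x^·-* : ∀ s c f k → (x^ s · (λ j → c * f j)) k ≡ c * (x^ s · f) k
x^·-* zero    c f k       = refl
x^·-* (suc s) c f zero    = sym (*-zeroʳ c)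
x^·-* (suc s) c f (suc k) = x^·-* s c f k

x^·δ₀ : ∀ s k → (x^ s · δ₀) k ≡ 𝟙 (s ≡ᵇ k)
x^·δ₀ zero    zero    = refl
x^·δ₀ zero    (suc k) = refl
x^·δ₀ (suc s) zero    = refl
x^·δ₀ (suc s) (suc k) = x^·δ₀ s k

x^·[1+rx+x²]· : ∀ s r f k →
  (x^ s · ([1+ r x+x²]· f)) k ≡ (x^ (s + 0) · f) k + r * (x^ (s + 1) · f) k + (x^ (s + 2) · f) k
x^·[1+rx+x²]· s r f k = begin
  (x^ s · ([1+ r x+x²]· f)) k
    ≡⟨ x^·-+ s (λ j → f j + r * (x^ 1 · f) j) (x^ 2 · f) k ⟩
  (x^ s · (λ j → f j + r * (x^ 1 · f) j)) k + (x^ s · (x^ 2 · f)) k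
    ≡⟨ cong (_+ (x^ s · (x^ 2 · f)) k) (x^·-+ s f (λ j → r * (x^ 1 · f) j) k) ⟩
  (x^ s · f) k + (x^ s · (λ j → r * (x^ 1 · f) j)) k + (x^ s · (x^ 2 · f)) k
    ≡⟨ cong (λ z → (x^ s · f) k + z + (x^ s · (x^ 2 · f)) k) (x^·-* s r (x^ 1 · f) k) ⟩
  (x^ s · f) k + r * (x^ s · (x^ 1 · f)) k + (x^ s · (x^ 2 · f)) k
    ≡⟨ sym (cong₂ _+_ (cong₂ (λ a b → a + r * b) (x^+· s 0 f k) (x^+· s 1 f k)) (x^+· s 2 f k)) ⟩
  (x^ (s + 0) · f) k + r * (x^ (s + 1) · f) k + (x^ (s + 2) · f) k ∎
  where open ≡-Reasoning

-- coronaTerm r A = x^|A| (1 + r x + x²)^(n − |A|): a vertex of G in A contributes the factor x,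
-- a vertex outside A the independence polynomial of its copy of H.
coronaTerm : ∀ {n} → ℕ → Subset n → ℕ → ℕ
coronaTerm r []          = δ₀
coronaTerm r (true ∷ A)  = x^ 1 · coronaTerm r A
coronaTerm r (false ∷ A) = [1+ r x+x²]· coronaTerm r A

module _ {m r} {H : Graph m} (poly : IndependencePoly≡1+ r x+x² H) where

  -- s is the size of the part of the independent set that has already been chosen.
  ∑-compatible : ∀ {n} (A : Subset n) s k →
    ∑ⱽ n m (λ Bs → 𝟙 (compatible H A Bs) * 𝟙 (s + ∣ A ∣ + ∣ concat Bs ∣ ≡ᵇ k))
      ≡ (x^ s · coronaTerm r A) k
  ∑-compatible [] s k = begin
    𝟙 (s + 0 + 0 ≡ᵇ k) + 0 ≡⟨ +-identityʳ _ ⟩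
    𝟙 (s + 0 + 0 ≡ᵇ k)     ≡⟨ cong (λ t → 𝟙 (t ≡ᵇ k)) (trans (+-identityʳ (s + 0)) (+-identityʳ s)) ⟩
    𝟙 (s ≡ᵇ k)             ≡⟨ sym (x^·δ₀ s k) ⟩
    (x^ s · δ₀) k          ∎
    where open ≡-Reasoning
  ∑-compatible {suc n} (true ∷ A) s k = begin
    ∑ m (λ B → ∑ⱽ n m (λ Bs → 𝟙 (isEmpty B ∧ compatible H A Bs)
                              * 𝟙 (s + suc ∣ A ∣ + ∣ B ++ concat Bs ∣ ≡ᵇ k)))
      ≡⟨ ∑-cong m (λ B → trans (∑ⱽ-cong n m (λ Bs → 𝟙-∧-* (isEmpty B) _ _))
                               (∑ⱽ-*ˡ n m (𝟙 (isEmpty B)) _)) ⟩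
    ∑ m (λ B → 𝟙 (isEmpty B) * ∑ⱽ n m (λ Bs → 𝟙 (compatible H A Bs)
                                               * 𝟙 (s + suc ∣ A ∣ + ∣ B ++ concat Bs ∣ ≡ᵇ k)))
      ≡⟨ ∑-isEmpty m _ ⟩
    ∑ⱽ n m (λ Bs → 𝟙 (compatible H A Bs) * 𝟙 (s + suc ∣ A ∣ + ∣ ⊥ {m} ++ concat Bs ∣ ≡ᵇ k))
      ≡⟨ ∑ⱽ-cong n m (λ Bs → cong (λ t → 𝟙 (compatible H A Bs) * 𝟙 (t ≡ᵇ k)) (size≡ (concat Bs))) ⟩
    ∑ⱽ n m (λ Bs → 𝟙 (compatible H A Bs) * 𝟙 (s + 1 + ∣ A ∣ + ∣ concat Bs ∣ ≡ᵇ k))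
      ≡⟨ ∑-compatible A (s + 1) k ⟩
    (x^ (s + 1) · coronaTerm r A) k
      ≡⟨ x^+· s 1 (coronaTerm r A) k ⟩
    (x^ s · coronaTerm r (true ∷ A)) k ∎
    where
    open ≡-Reasoning
    size≡ : ∀ (C : Subset (n * m)) → s + suc ∣ A ∣ + ∣ ⊥ {m} ++ C ∣ ≡ s + 1 + ∣ A ∣ + ∣ C ∣
    size≡ C = cong₂ _+_ (sym (+-assoc s 1 ∣ A ∣))
                        (trans (∣++∣ (⊥ {m}) C) (cong (_+ ∣ C ∣) (∣⊥∣≡0 m)))
  ∑-compatible {suc n} (false ∷ A) s k = begin
    ∑ m (λ B → ∑ⱽ n m (λ Bs → 𝟙 (isIndependent H B ∧ compatible H A Bs)
                              * 𝟙 (s + ∣ A ∣ + ∣ B ++ concat Bs ∣ ≡ᵇ k)))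
      ≡⟨ ∑-cong m (λ B → trans (∑ⱽ-cong n m (regroup B)) (∑ⱽ-*ˡ n m (𝟙 (isIndependent H B)) _)) ⟩
    ∑ m (λ B → 𝟙 (isIndependent H B) * ∑ⱽ n m (λ Bs → 𝟙 (compatible H A Bs)
                                                     * 𝟙 (s + ∣ B ∣ + ∣ A ∣ + ∣ concat Bs ∣ ≡ᵇ k)))
      ≡⟨ ∑-cong m (λ B → cong (𝟙 (isIndependent H B) *_) (∑-compatible A (s + ∣ B ∣) k)) ⟩
    ∑ m (λ B → 𝟙 (isIndependent H B) * (x^ (s + ∣ B ∣) · coronaTerm r A) k)
      ≡⟨ poly (λ t → (x^ (s + t) · coronaTerm r A) k) ⟩
    (x^ (s + 0) · coronaTerm r A) k + r * (x^ (s + 1) · coronaTerm r A) k + (x^ (s + 2) · coronaTerm r A) k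
      ≡⟨ sym (x^·[1+rx+x²]· s r (coronaTerm r A) k) ⟩
    (x^ s · coronaTerm r (false ∷ A)) k ∎
    where
    open ≡-Reasoning
    size≡ : ∀ (B : Subset m) (C : Subset (n * m)) → s + ∣ A ∣ + ∣ B ++ C ∣ ≡ s + ∣ B ∣ + ∣ A ∣ + ∣ C ∣
    size≡ B C = trans (cong (s + ∣ A ∣ +_) (∣++∣ B C)) (shuffle s (∣ A ∣) (∣ B ∣) (∣ C ∣))
      where
      shuffle : ∀ s a b c → s + a + (b + c) ≡ s + b + a + c
      shuffle = solve-∀
    regroup : ∀ B Bs →
      𝟙 (isIndependent H B ∧ compatible H A Bs) * 𝟙 (s + ∣ A ∣ + ∣ B ++ concat Bs ∣ ≡ᵇ k)
        ≡ 𝟙 (isIndependent H B) * (𝟙 (compatible H A Bs) * 𝟙 (s + ∣ B ∣ + ∣ A ∣ + ∣ concat Bs ∣ ≡ᵇ k))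
    regroup B Bs = trans (𝟙-∧-* (isIndependent H B) _ _)
                         (cong (λ t → 𝟙 (isIndependent H B) * (𝟙 (compatible H A Bs) * 𝟙 (t ≡ᵇ k)))
                               (size≡ B (concat Bs)))

  indepCoeff-corona : ∀ {n} (G : Graph n) k →
    indepCoeff (corona G H) k ≡ ∑ n (λ A → 𝟙 (isIndependent G A) * coronaTerm r A k)
  indepCoeff-corona {n} G k = begin
    indepCoeff (corona G H) k
      ≡⟨ indepCoeff≡∑ (corona G H) k ⟩
    ∑ (n + n * m) (λ S → 𝟙 (isIndependent (corona G H) S ∧ (∣ S ∣ ≡ᵇ k)))
      ≡⟨ ∑-++ n (n * m) _ ⟩
    ∑ n (λ A → ∑ (n * m) (λ C → 𝟙 (isIndependent (corona G H) (A ++ C) ∧ (∣ A ++ C ∣ ≡ᵇ k))))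
      ≡⟨ ∑-cong n (λ A → trans (∑-concat n m _) (trans (∑ⱽ-cong n m (split-summand A))
                                                          (∑ⱽ-*ˡ n m (𝟙 (isIndependent G A)) _))) ⟩
    ∑ n (λ A → 𝟙 (isIndependent G A) * ∑ⱽ n m (λ Bs → 𝟙 (compatible H A Bs)
                                                    * 𝟙 (0 + ∣ A ∣ + ∣ concat Bs ∣ ≡ᵇ k)))
      ≡⟨ ∑-cong n (λ A → cong (𝟙 (isIndependent G A) *_) (∑-compatible A 0 k)) ⟩
    ∑ n (λ A → 𝟙 (isIndependent G A) * coronaTerm r A k) ∎
    where
    open ≡-Reasoning
    split-summand : ∀ A Bs →
      𝟙 (isIndependent (corona G H) (A ++ concat Bs) ∧ (∣ A ++ concat Bs ∣ ≡ᵇ k))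
        ≡ 𝟙 (isIndependent G A) * (𝟙 (compatible H A Bs) * 𝟙 (0 + ∣ A ∣ + ∣ concat Bs ∣ ≡ᵇ k))
    split-summand A Bs rewrite isIndependent-corona G H A Bs | ∣++∣ A (concat Bs) =
      trans (𝟙-∧ (isIndependent G A ∧ compatible H A Bs) _) (𝟙-∧-* (isIndependent G A) _ _)

-- Symmetric unimodal sequences

-- d is a formal degree: f 0, …, f d is a palindrome rising towards the middle, whose end
-- coefficients may vanish (as for x · f, of degree d + 2 when f has degree d).
record SymmetricUnimodal (d : ℕ) (f : ℕ → ℕ) : Set where
  field
    symmetric  : ∀ i j → i + j ≡ d → f i ≡ f j
    vanishing  : ∀ i → d < i → f i ≡ 0
    increasing : ∀ i → suc (i + i) ≤ d → f i ≤ f (suc i)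

  decreasing : ∀ i → d ≤ suc (i + i) → f (suc i) ≤ f i
  decreasing i d≤2i+1 with d ≤? i
  ... | yes d≤i = subst (_≤ f i) (sym (vanishing (suc i) (s≤s d≤i))) z≤n
  ... | no d≰i with m≤n⇒∃[o]m+o≡n (≰⇒> d≰i)
  ...   | j , refl = begin
    f (suc i)     ≡⟨ symmetric (suc i) j refl ⟩
    f j           ≤⟨ increasing j (s≤s (+-monoˡ-≤ j j≤i)) ⟩
    f (suc j)     ≡⟨ symmetric (suc j) i (cong suc (+-comm j i)) ⟩
    f i           ∎
    where
    open ≤-Reasoning
    j≤i : j ≤ i
    j≤i = +-cancelˡ-≤ i j i (s≤s⁻¹ d≤2i+1)
open SymmetricUnimodal

SymmetricUnimodal-cong : ∀ {d f g} → (∀ k → f k ≡ g k) →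
                         SymmetricUnimodal d f → SymmetricUnimodal d g
SymmetricUnimodal-cong f≗g F = record
  { symmetric  = λ i j i+j≡d → trans (sym (f≗g i)) (trans (symmetric F i j i+j≡d) (f≗g j))
  ; vanishing  = λ i d<i → trans (sym (f≗g i)) (vanishing F i d<i)
  ; increasing = λ i 2i<d → subst₂ _≤_ (f≗g i) (f≗g (suc i)) (increasing F i 2i<d)
  }

SymmetricUnimodal-+ : ∀ {d f g} → SymmetricUnimodal d f → SymmetricUnimodal d g →
                      SymmetricUnimodal d (λ k → f k + g k)
SymmetricUnimodal-+ F G = record
  { symmetric  = λ i j i+j≡d → cong₂ _+_ (symmetric F i j i+j≡d) (symmetric G i j i+j≡d)
  ; vanishing  = λ i d<i → cong₂ _+_ (vanishing F i d<i) (vanishing G i d<i)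
  ; increasing = λ i 2i<d → +-mono-≤ (increasing F i 2i<d) (increasing G i 2i<d)
  }

SymmetricUnimodal-* : ∀ {d f} c → SymmetricUnimodal d f → SymmetricUnimodal d (λ k → c * f k)
SymmetricUnimodal-* c F = record
  { symmetric  = λ i j i+j≡d → cong (c *_) (symmetric F i j i+j≡d)
  ; vanishing  = λ i d<i → trans (cong (c *_) (vanishing F i d<i)) (*-zeroʳ c)
  ; increasing = λ i 2i<d → *-monoʳ-≤ c (increasing F i 2i<d)
  }

SymmetricUnimodal-∑ : ∀ N {d} (w : Subset N → ℕ → ℕ) → (∀ A → SymmetricUnimodal d (w A)) →
                      SymmetricUnimodal d (λ k → ∑ N (λ A → w A k))
SymmetricUnimodal-∑ zero    w W = W []
SymmetricUnimodal-∑ (suc N) w W =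
  SymmetricUnimodal-+ (SymmetricUnimodal-∑ N (w ∘ (true ∷_)) (W ∘ (true ∷_)))
                      (SymmetricUnimodal-∑ N (w ∘ (false ∷_)) (W ∘ (false ∷_)))

SymmetricUnimodal-δ₀ : SymmetricUnimodal 0 δ₀
SymmetricUnimodal-δ₀ = record
  { symmetric  = λ { zero zero _ → refl }
  ; vanishing  = λ { (suc i) _ → refl }
  ; increasing = λ i ()
  }

SymmetricUnimodal-x· : ∀ {d f} → SymmetricUnimodal d f → SymmetricUnimodal (2 + d) (x^ 1 · f)
SymmetricUnimodal-x· {d} {f} F = record
  { symmetric  = sym′
  ; vanishing  = λ { (suc i) (s≤s d+1<i) → vanishing F i (≤-trans (n≤1+n _) d+1<i) }
  ; increasing = incr
  }
  where
  incr : ∀ i → suc (i + i) ≤ 2 + d → (x^ 1 · f) i ≤ (x^ 1 · f) (suc i)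
  incr zero    _              = z≤n
  incr (suc i) (s≤s 2i+2<d+2) = increasing F i (s≤s⁻¹ (subst (_≤ suc d) (cong suc (+-suc i i)) 2i+2<d+2))
  sym′ : ∀ i j → i + j ≡ 2 + d → (x^ 1 · f) i ≡ (x^ 1 · f) j
  sym′ zero    (suc j) refl  = sym (vanishing F (suc d) ≤-refl)
  sym′ (suc i) zero    i+0≡ =
    vanishing F i (≤-reflexive (sym (suc-injective (trans (sym (+-identityʳ (suc i))) i+0≡))))
  sym′ (suc i) (suc j) i+j≡ =
    symmetric F i j (suc-injective (suc-injective (trans (cong suc (sym (+-suc i j))) i+j≡)))

[1+x]·_ : (ℕ → ℕ) → ℕ → ℕ
([1+x]· f) k = f k + (x^ 1 · f) k

SymmetricUnimodal-[1+x]· : ∀ {d f} → SymmetricUnimodal d f → SymmetricUnimodal (suc d) ([1+x]· f)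
SymmetricUnimodal-[1+x]· {d} {f} F = record
  { symmetric  = sym′
  ; vanishing  = λ { (suc i) (s≤s d<i) →
                       cong₂ _+_ (vanishing F (suc i) (≤-trans d<i (n≤1+n i))) (vanishing F i d<i) }
  ; increasing = incr
  }
  where
  ends : ([1+x]· f) 0 ≡ ([1+x]· f) (suc d)
  ends = trans (+-identityʳ (f 0))
               (trans (symmetric F 0 d refl) (cong (_+ f d) (sym (vanishing F (suc d) ≤-refl))))
  sym′ : ∀ i j → i + j ≡ suc d → ([1+x]· f) i ≡ ([1+x]· f) j
  sym′ zero    (suc j) refl = ends
  sym′ (suc i) zero    i+0≡ with trans (sym (+-identityʳ (suc i))) i+0≡
  ... | refl = sym ends
  sym′ (suc i) (suc j) i+j≡ = trans (cong₂ _+_ (symmetric F (suc i) j (trans (sym (+-suc i j)) i+j≡′))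
                                                (symmetric F i (suc j) i+j≡′))
                                     (+-comm (f j) (f (suc j)))
    where
    i+j≡′ : i + suc j ≡ d
    i+j≡′ = suc-injective i+j≡
  two-step : ∀ i → suc (suc (i + i)) ≤ d → f i ≤ f (suc (suc i))
  two-step i 2i+2≤d with suc (suc i + suc i) ≤? d
  ... | yes 2i+3≤d =
    ≤-trans (increasing F i (≤-trans (n≤1+n _) 2i+2≤d)) (increasing F (suc i) 2i+3≤d)
  ... | no  2i+3≰d = ≤-reflexive (symmetric F i (suc (suc i)) (≤-antisym
                       (subst (_≤ d) i+i+2≡ 2i+2≤d)
                       (subst (d ≤_) (sym (+-suc i (suc i))) (s≤s⁻¹ (≰⇒> 2i+3≰d)))))
    where
    i+i+2≡ : suc (suc (i + i)) ≡ i + suc (suc i)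
    i+i+2≡ = sym (trans (+-suc i (suc i)) (cong suc (+-suc i i)))
  incr : ∀ i → suc (i + i) ≤ suc d → ([1+x]· f) i ≤ ([1+x]· f) (suc i)
  incr zero    _             = ≤-trans (≤-reflexive (+-identityʳ (f 0))) (m≤n+m (f 0) (f 1))
  incr (suc i) (s≤s 2i+2≤d) =
    ≤-trans (≤-reflexive (+-comm (f (suc i)) (f i)))
            (+-monoˡ-≤ (f (suc i)) (two-step i (subst (_≤ d) (cong suc (+-suc i i)) 2i+2≤d)))

-- 1 + r x + x² = (1 + x)² + (r − 2) x.
SymmetricUnimodal-[1+rx+x²]· : ∀ {d f} r → SymmetricUnimodal d f →
  SymmetricUnimodal (2 + d) ([1+ suc (suc r) x+x²]· f)
SymmetricUnimodal-[1+rx+x²]· {d} {f} r F =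
  SymmetricUnimodal-cong factor
    (SymmetricUnimodal-+ (SymmetricUnimodal-[1+x]· (SymmetricUnimodal-[1+x]· F))
                         (SymmetricUnimodal-* r (SymmetricUnimodal-x· F)))
  where
  factor : ∀ k → ([1+x]· ([1+x]· f)) k + r * (x^ 1 · f) k ≡ ([1+ suc (suc r) x+x²]· f) k
  factor zero    = constant-term (f 0) r
    where
    constant-term : ∀ a r → a + 0 + 0 + r * 0 ≡ a + suc (suc r) * 0 + 0
    constant-term = solve-∀
  factor (suc k) = higher-term (f (suc k)) (f k) ((x^ 1 · f) k) r
    where
    higher-term : ∀ a b c r → a + b + (b + c) + r * b ≡ a + suc (suc r) * b + c
    higher-term = solve-∀

coronaTerm-symmetricUnimodal : ∀ {n} r (A : Subset n) →
                               SymmetricUnimodal (n + n) (coronaTerm (suc (suc r)) A)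
coronaTerm-symmetricUnimodal r [] = SymmetricUnimodal-δ₀
coronaTerm-symmetricUnimodal {suc n} r (a ∷ A) =
  subst (λ d → SymmetricUnimodal d (coronaTerm (suc (suc r)) (a ∷ A))) (cong suc (sym (+-suc n n)))
        (step a)
  where
  step : ∀ a → SymmetricUnimodal (2 + (n + n)) (coronaTerm (suc (suc r)) (a ∷ A))
  step true  = SymmetricUnimodal-x· (coronaTerm-symmetricUnimodal r A)
  step false = SymmetricUnimodal-[1+rx+x²]· r (coronaTerm-symmetricUnimodal r A)

rising-up-to-centre : ∀ {m f} → SymmetricUnimodal (m + m) f → ∀ k → k ≤ m → (x^ 1 · f) k ≤ f k
rising-up-to-centre F zero    _   = z≤n
rising-up-to-centre F (suc k) k<m = increasing F k (+-mono-≤ k<m (≤-trans (n≤1+n k) k<m))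

mirror-of-centre : ∀ {m f} → SymmetricUnimodal (m + m) f → f (suc m) ≡ (x^ 1 · f) m
mirror-of-centre {zero}   F = vanishing F 1 ≤-refl
mirror-of-centre {suc m′} F = symmetric F (suc (suc m′)) m′ (cong suc (sym (+-suc m′ m′)))

-- The two central coefficients of (1 + r x + x²) f when f has centre m, with a = f (m − 1),
-- b = f (m − 2), c = f m and f (m + 1) = a.
quadratic-rise : ∀ r {a b c} → b ≤ a → a < c → c + suc (suc r) * a + b < a + suc (suc r) * c + a
quadratic-rise r {a} {b} b≤a a<c with m≤n⇒∃[o]m+o≡n a<c
... | x , refl with m≤n⇒∃[o]m+o≡n b≤a
...   | y , refl = ≤-trans (m≤m+n _ _) (≤-reflexive (gap b y x r))
  where
  gap : ∀ b y x r → suc (suc (b + y) + x + suc (suc r) * (b + y) + b) + (y + x + r * suc x)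
                  ≡ b + y + suc (suc r) * (suc (b + y) + x) + (b + y)
  gap = solve-∀

-- (x^ 1 · f) m is f (m − 1), read as 0 when m = 0.
[1+rx+x²]·-rises : ∀ r {m f} → SymmetricUnimodal (m + m) f → (x^ 1 · f) m < f m →
  (x^ 1 · [1+ suc (suc r) x+x²]· f) (suc m) < ([1+ suc (suc r) x+x²]· f) (suc m)
[1+rx+x²]·-rises r {m} {f} F rises =
  subst (λ c → f m + suc (suc r) * (x^ 1 · f) m + (x^ 2 · f) m < c + suc (suc r) * f m + (x^ 1 · f) m)
        (sym (mirror-of-centre F))
        (quadratic-rise r (two-before m ≤-refl) rises)
  where
  two-before : ∀ k → k ≤ m → (x^ 2 · f) k ≤ (x^ 1 · f) k
  two-before zero    _   = z≤n
  two-before (suc k) k<m = rising-up-to-centre F k (≤-trans (n≤1+n k) k<m)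

coronaTerm-⊥-rises : ∀ r m →
  (x^ 1 · coronaTerm (suc (suc r)) (⊥ {m})) m < coronaTerm (suc (suc r)) (⊥ {m}) m
coronaTerm-⊥-rises r zero    = s≤s z≤n
coronaTerm-⊥-rises r (suc m) =
  [1+rx+x²]·-rises r (coronaTerm-symmetricUnimodal r (⊥ {m})) (coronaTerm-⊥-rises r m)

module _ (r : ℕ) where

  private
    K : Graph (suc (suc r))
    K = Kminus-e (suc (suc r))

  indepCoeff-corona-symmetricUnimodal : ∀ {n} (G : Graph n) →
                                        SymmetricUnimodal (n + n) (indepCoeff (corona G K))
  indepCoeff-corona-symmetricUnimodal {n} G =
    SymmetricUnimodal-cong (sym ∘ indepCoeff-corona (Kminus-e-independencePoly r) G)
      (SymmetricUnimodal-∑ n _ λ A →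
        SymmetricUnimodal-* (𝟙 (isIndependent G A)) (coronaTerm-symmetricUnimodal r A))

  indepCoeff-corona-rises : ∀ {n} (G : Graph (suc n)) →
                            indepCoeff (corona G K) n < indepCoeff (corona G K) (suc n)
  indepCoeff-corona-rises {n} G =
    subst₂ _<_ (sym (indepCoeff-corona (Kminus-e-independencePoly r) G n))
               (sym (indepCoeff-corona (Kminus-e-independencePoly r) G (suc n)))
      (∑-mono-< (suc n) ⊥ weakly strictly-at-⊥)
    where
    term : Subset (suc n) → ℕ → ℕ
    term A k = 𝟙 (isIndependent G A) * coronaTerm (suc (suc r)) A k
    weakly : ∀ A → term A n ≤ term A (suc n)
    weakly A = *-monoʳ-≤ (𝟙 (isIndependent G A))
                         (rising-up-to-centre (coronaTerm-symmetricUnimodal r A) (suc n) ≤-refl)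
    strictly-at-⊥ : term ⊥ n < term ⊥ (suc n)
    strictly-at-⊥ rewrite isIndependent-⊥ G = +-monoˡ-< 0 (coronaTerm-⊥-rises r (suc n))

indepCoeff-0-positive : ∀ {N} (F : Graph N) → 0 < indepCoeff F 0
indepCoeff-0-positive {N} F = subst₂ _<_ (∑-*ˡ N 0 (λ _ → 0)) (sym (indepCoeff≡∑ F 0))
  (∑-mono-< N ⊥ (λ _ → z≤n)
    (subst₂ (λ b k → 0 < 𝟙 (b ∧ (k ≡ᵇ 0))) (sym (isIndependent-⊥ F)) (sym (∣⊥∣≡0 N)) (s≤s z≤n)))

foldr-⊔-lub : ∀ {A : Set} (f : A → ℕ) {M} xs →
              (∀ {x} → x ∈ xs → f x ≤ M) → foldr _⊔_ 0 (map f xs) ≤ M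
foldr-⊔-lub f []       bound = z≤n
foldr-⊔-lub f (x ∷ xs) bound = ⊔-lub (bound (here refl)) (foldr-⊔-lub f xs (λ x∈ → bound (there x∈)))

foldr-⊔-upper : ∀ {A : Set} (f : A → ℕ) {x} xs → x ∈ xs → f x ≤ foldr _⊔_ 0 (map f xs)
foldr-⊔-upper f (y ∷ xs) (here refl) = m≤m⊔n (f y) _
foldr-⊔-upper f (y ∷ xs) (there x∈) = m≤n⇒m≤o⊔n (f y) (foldr-⊔-upper f xs x∈)

witness-of-filterᵇ : ∀ {A : Set} (p : A → Bool) xs →
                     0 < length (filterᵇ p xs) → ∃ λ x → x ∈ xs × T (p x)
witness-of-filterᵇ p xs nonempty with filterᵇ p xs in eq | nonempty
... | y ∷ _ | _ = y , ∈-filter⁻ (T? ∘ p) (subst (y ∈_) (sym eq) (here refl))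

indepNumber≡ : ∀ {N} (F : Graph N) d → (∀ k → d < k → indepCoeff F k ≡ 0) → 0 < indepCoeff F d →
  indepNumber F ≡ d
indepNumber≡ F d beyond-d at-d = ≤-antisym (foldr-⊔-lub ∣_∣ (independentSets F) size≤d) d≤size
  where
  counted : ∀ {S} → S ∈ independentSets F → 0 < indepCoeff F ∣ S ∣
  counted {S} S∈ = filter-some (T? ∘ (_≡ᵇ ∣ S ∣) ∘ ∣_∣) (Any.map (λ { refl → ≡⇒≡ᵇ ∣ S ∣ ∣ S ∣ refl }) S∈)
  size≤d : ∀ {S} → S ∈ independentSets F → ∣ S ∣ ≤ d
  size≤d {S} S∈ with ∣ S ∣ ≤? d
  ... | yes ≤d = ≤d
  ... | no  ≰d = ⊥-elim (<-irrefl (sym (beyond-d ∣ S ∣ (≰⇒> ≰d))) (counted S∈))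
  d≤size : d ≤ indepNumber F
  d≤size = let (S , S∈ , size) = witness-of-filterᵇ (λ S → ∣ S ∣ ≡ᵇ d) (independentSets F) at-d in
    subst (_≤ indepNumber F) (≡ᵇ⇒≡ ∣ S ∣ d size) (foldr-⊔-upper ∣_∣ (independentSets F) S∈)

symmetric-unimodal-with-unique-mode : ∀ {n c} → SymmetricUnimodal (suc n + suc n) c → c n < c (suc n) →
  Symmetric c (suc n + suc n) × Unimodal c (suc n + suc n) × UniqueModeAt c (suc n + suc n) (suc n)
symmetric-unimodal-with-unique-mode {n} {c} C rises =
  (λ i i≤N → symmetric C i (N ∸ i) (m+[n∸m]≡n i≤N)) , (suc n , mode) , mode , unique
  where
  N : ℕ
  N = suc n + suc n
  mode : IsMode c N (suc n)
  mode = m≤m+n (suc n) (suc n)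
       , (λ i i<n → increasing C i (+-mono-≤ i<n (<⇒≤ i<n)))
       , (λ i n≤i _ → decreasing C i (≤-trans (+-mono-≤ n≤i n≤i) (n≤1+n _)))
  unique : ∀ k → IsMode c N k → k ≡ suc n
  unique k (_ , up , down) with <-cmp k (suc n)
  ... | tri< k<n _ _ = ⊥-elim (≤⇒≯ (down n (s≤s⁻¹ k<n) (m≤m+n (suc n) (suc n))) rises)
  ... | tri≈ _ k≡n _ = k≡n
  ... | tri> _ _ n<k = ⊥-elim (≤⇒≯ (subst (c (suc n) ≤_) mirror (up (suc n) n<k)) rises)
    where
    mirror : c (suc (suc n)) ≡ c n
    mirror = symmetric C (suc (suc n)) n (cong suc (sym (+-suc n n)))

theorem2p9 : (r : ℕ) → 2 ≤ r → (n : ℕ) → 1 ≤ n → (G : Graph n) →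
    Symmetric (indepCoeff (corona G (Kminus-e r))) (indepNumber (corona G (Kminus-e r)))
    × Unimodal (indepCoeff (corona G (Kminus-e r))) (indepNumber (corona G (Kminus-e r)))
    × UniqueModeAt (indepCoeff (corona G (Kminus-e r))) (indepNumber (corona G (Kminus-e r))) n
theorem2p9 (suc (suc r)) (s≤s (s≤s z≤n)) (suc n) (s≤s z≤n) G =
  subst (λ N → Symmetric c N × Unimodal c N × UniqueModeAt c N (suc n)) (sym degree)
        (symmetric-unimodal-with-unique-mode C (indepCoeff-corona-rises r G))
  where
  c : ℕ → ℕ
  c = indepCoeff (corona G (Kminus-e (suc (suc r))))
  C : SymmetricUnimodal (suc n + suc n) c
  C = indepCoeff-corona-symmetricUnimodal r G
  degree : indepNumber (corona G (Kminus-e (suc (suc r)))) ≡ suc n + suc n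
  degree = indepNumber≡ (corona G (Kminus-e (suc (suc r)))) (suc n + suc n) (vanishing C)
             (subst (0 <_) (symmetric C 0 (suc n + suc n) refl)
                    (indepCoeff-0-positive (corona G (Kminus-e (suc (suc r))))))
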